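{- Let $k_\mathcal{G}=n_\mathcal{G}\ge1$ and $k_\mathcal{H}=n_\mathcal{H}-1\ge1$. Then the polynomials $s_g=\big(\sum_{h\in V(\mathcal{H})}x_{gh}\big)-(n_\mathcal{H}-1)$, $g\in V(\mathcal{G})$, form a $1$-sum-of-squares certificate of $f_{\mathrm{viz}}$, i.e. $f_{\mathrm{viz}}\equiv\sum_{g\in V(\mathcal{G})}s_g^2\pmod{I_{\mathrm{viz}}}$; consequently $\gamma(G)\gamma(H)\le\gamma(G\Box H)$ for all graphs $G$ on $n_\mathcal{G}$ vertices with $\gamma(G)=n_\mathcal{G}$ and $H$ on $n_\mathcal{H}$ vertices with $\gamma(H)=n_\mathcal{H}-1$.
   Context: $\mathbb{K}$ is a subfield of $\mathbb{R}$. $V(\mathcal{G})$ is a set of $n_\mathcal{G}$ vertices with fixed subset $D_\mathcal{G}$ of size $k_\mathcal{G}$; $V(\mathcal{H})$ a disjoint set of $n_\mathcal{H}$ vertices with fixed subset $D_\mathcal{H}$ of size $k_\mathcal{H}$. Variables $e_{gg'}=e_{g'g}$ for 2-subsets of $V(\mathcal{G})$, $e_{hh'}$ for 2-subsets of $V(\mathcal{H})$, $x_{gh}$ for $g\in V(\mathcal{G}),h\in V(\mathcal{H})$; $P$ is the polynomial ring over $\mathbb{K}$ in these. $I_{\mathrm{viz}}\subseteq P$ is generated by: $e_{gg'}^2-e_{gg'}$; $\prod_{g'\in D_\mathcal{G}}(1-e_{gg'})$ for $g\in V(\mathcal{G})\setminus D_\mathcal{G}$; $\prod_{g'\in V(\mathcal{G})\setminus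 S}\sum_{g\in S}e_{gg'}$ for $S\subseteq V(\mathcal{G})$, $|S|=k_\mathcal{G}-1$; the same three families for $\mathcal{H}$; $x_{gh}^2-x_{gh}$; and $(1-x_{gh})\prod_{g'\ne g}(1-e_{gg'}x_{g'h})\prod_{h'\ne h}(1-e_{hh'}x_{gh'})$ for all $g,h$. $f_{\mathrm{viz}}=\sum_{g,h}x_{gh}-k_\mathcal{G}k_\mathcal{H}$. $\gamma(\cdot)$ is the domination number, $G\Box H$ the Cartesian product graph. An $\ell$-sum-of-squares certificate of $f$ modulo $I$ is a family of polynomials $s_i$ of degree $\le\ell$ with $f-\sum s_i^2\in I$. -}

module Defs where

open import Level using (Level; _⊔_; 0ℓ) renaming (suc to lsuc)
open import Algebra.Bundles using (CommutativeRing)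
open import Data.Nat as ℕ using (ℕ; zero; suc)
open import Data.Fin as Fin using (Fin)
open import Data.Fin.Properties using (<-cmp; _≟_)
open import Data.Fin.Subset using (Subset; _∈_; _∉_; ∁; ∣_∣)
open import Data.Fin.Subset.Properties using (_∈?_)
open import Data.List as List using (List; []; _∷_; map; foldr; filter; allFin; length; concatMap)
open import Data.List.Membership.Propositional using () renaming (_∈_ to _∈ₗ_)
open import Data.List.Relation.Unary.Unique.Propositional using (Unique)
open import Data.Product using (_×_; _,_; ∃; ∃-syntax)
open import Data.Sum using (_⊎_; inj₁; inj₂)
open import Relation.Nullary using (¬_; ¬?)
open import Relation.Binary.Definitions using (tri<; tri≈; tri>)
open import Relation.Binary.PropositionalEquality using (_≡_; refl) renaming (sym to ≡-sym)

-- Characteristic-zero fields (stand-in for "K a subfield of ℝ")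

module _ {c ℓ} (K : CommutativeRing c ℓ) where
  open CommutativeRing K

  natK : ℕ → Carrier
  natK zero    = 0#
  natK (suc n) = 1# + natK n

  record IsCharZeroField : Set (c ⊔ ℓ) where
    field
      1≉0      : ¬ (1# ≈ 0#)
      inverse  : ∀ x → ¬ (x ≈ 0#) → ∃[ y ] (x * y ≈ 1#)
      charZero : ∀ n → ¬ (natK (suc n) ≈ 0#)

-- The polynomial ring R[V] (free commutative R-algebra on the variables V),
-- presented as expressions modulo the commutative-R-algebra laws,
-- and ideals generated by an indexed family of polynomials.

module Poly {c ℓ} (R : CommutativeRing c ℓ) (V : Set) where
  open CommutativeRing R using (Carrier; _≈_; _+_; _*_; 0#; 1#)

  infixl 6 _⊕_
  infixl 7 _⊗_
  infix  8 ⊖_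
  infix  4 _≋_

  data Expr : Set c where
    con  : Carrier → Expr
    var  : V → Expr
    _⊕_  : Expr → Expr → Expr
    _⊗_  : Expr → Expr → Expr
    ⊖_   : Expr → Expr

  data _≋_ : Expr → Expr → Set (c ⊔ ℓ) where
    ≋-refl    : ∀ {p} → p ≋ p
    ≋-sym     : ∀ {p q} → p ≋ q → q ≋ p
    ≋-trans   : ∀ {p q r} → p ≋ q → q ≋ r → p ≋ r
    ⊕-cong    : ∀ {p p' q q'} → p ≋ p' → q ≋ q' → p ⊕ q ≋ p' ⊕ q'
    ⊗-cong    : ∀ {p p' q q'} → p ≋ p' → q ≋ q' → p ⊗ q ≋ p' ⊗ q'
    ⊖-cong    : ∀ {p q} → p ≋ q → ⊖ p ≋ ⊖ q
    ⊕-assoc   : ∀ p q r → (p ⊕ q) ⊕ r ≋ p ⊕ (q ⊕ r)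
    ⊕-comm    : ∀ p q → p ⊕ q ≋ q ⊕ p
    ⊕-identityˡ : ∀ p → con 0# ⊕ p ≋ p
    ⊕-inverseˡ  : ∀ p → (⊖ p) ⊕ p ≋ con 0#
    ⊗-assoc   : ∀ p q r → (p ⊗ q) ⊗ r ≋ p ⊗ (q ⊗ r)
    ⊗-comm    : ∀ p q → p ⊗ q ≋ q ⊗ p
    ⊗-identityˡ : ∀ p → con 1# ⊗ p ≋ p
    distribˡ  : ∀ p q r → p ⊗ (q ⊕ r) ≋ (p ⊗ q) ⊕ (p ⊗ r)
    con-cong  : ∀ {a b} → a ≈ b → con a ≋ con b
    con-+     : ∀ a b → con (a + b) ≋ con a ⊕ con b
    con-*     : ∀ a b → con (a * b) ≋ con a ⊗ con b

  Σₗ : List Expr → Expr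
  Σₗ = foldr _⊕_ (con 0#)

  Πₗ : List Expr → Expr
  Πₗ = foldr _⊗_ (con 1#)

  nat : ℕ → Expr
  nat n = con (natK R n)

  _⊝_ : Expr → Expr → Expr
  p ⊝ q = p ⊕ ⊖ q
  infixl 6 _⊝_

  data InIdeal {Ix : Set} (gens : Ix → Expr) : Expr → Set (c ⊔ ℓ) where
    gen  : ∀ i → InIdeal gens (gens i)
    zero : InIdeal gens (con 0#)
    add  : ∀ {p q} → InIdeal gens p → InIdeal gens q → InIdeal gens (p ⊕ q)
    mul  : ∀ r {p} → InIdeal gens p → InIdeal gens (r ⊗ p)
    resp : ∀ {p q} → p ≋ q → InIdeal gens p → InIdeal gens q

elems : ∀ {n} → Subset n → List (Fin n)
elems {n} S = filter (_∈? S) (allFin n)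

others : ∀ {n} → Fin n → List (Fin n)
others {n} g = filter (λ g' → ¬? (g' ≟ g)) (allFin n)

data VizVar (nG nH : ℕ) : Set where
  eG : (g g' : Fin nG) → .(Fin._<_ g g') → VizVar nG nH
  eH : (h h' : Fin nH) → .(Fin._<_ h h') → VizVar nG nH
  x  : Fin nG → Fin nH → VizVar nG nH

module Viz {c ℓ} (K : CommutativeRing c ℓ) (nG nH : ℕ)
           (DG : Subset nG) (DH : Subset nH) where
  open CommutativeRing K using (0#; 1#)
  open Poly K (VizVar nG nH) public

  kG kH : ℕ
  kG = ∣ DG ∣
  kH = ∣ DH ∣

  -- e_{gg'} = e_{g'g} for g ≠ g' (the diagonal value is never used)
  eGG : Fin nG → Fin nG → Expr
  eGG g g' with <-cmp g g'
  ... | tri< a _ _ = var (eG g g' a)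
  ... | tri≈ _ _ _ = con 0#
  ... | tri> _ _ b = var (eG g' g b)

  eHH : Fin nH → Fin nH → Expr
  eHH h h' with <-cmp h h'
  ... | tri< a _ _ = var (eH h h' a)
  ... | tri≈ _ _ _ = con 0#
  ... | tri> _ _ b = var (eH h' h b)

  X : Fin nG → Fin nH → Expr
  X g h = var (x g h)

  one : Expr
  one = con 1#

  data Gen : Set where
    idemG : (g g' : Fin nG) → Fin._<_ g g' → Gen
    domG  : (g : Fin nG) → g ∉ DG → Gen
    covG  : (S : Subset nG) → ∣ S ∣ ≡ kG ℕ.∸ 1 → Gen
    idemH : (h h' : Fin nH) → Fin._<_ h h' → Gen
    domH  : (h : Fin nH) → h ∉ DH → Gen
    covH  : (S : Subset nH) → ∣ S ∣ ≡ kH ℕ.∸ 1 → Gen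
    idemX : Fin nG → Fin nH → Gen
    nbrX  : Fin nG → Fin nH → Gen

  gens : Gen → Expr
  gens (idemG g g' p) = var (eG g g' p) ⊗ var (eG g g' p) ⊝ var (eG g g' p)
  gens (domG g _)     = Πₗ (map (λ g' → one ⊝ eGG g g') (elems DG))
  gens (covG S _)     = Πₗ (map (λ g' → Σₗ (map (λ g → eGG g g') (elems S))) (elems (∁ S)))
  gens (idemH h h' p) = var (eH h h' p) ⊗ var (eH h h' p) ⊝ var (eH h h' p)
  gens (domH h _)     = Πₗ (map (λ h' → one ⊝ eHH h h') (elems DH))
  gens (covH S _)     = Πₗ (map (λ h' → Σₗ (map (λ h → eHH h h') (elems S))) (elems (∁ S)))
  gens (idemX g h)    = X g h ⊗ X g h ⊝ X g h
  gens (nbrX g h)     = (one ⊝ X g h)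
                        ⊗ Πₗ (map (λ g' → one ⊝ eGG g g' ⊗ X g' h) (others g))
                        ⊗ Πₗ (map (λ h' → one ⊝ eHH h h' ⊗ X g h') (others h))

  Iviz : Expr → Set (c ⊔ ℓ)
  Iviz = InIdeal gens

  fviz : Expr
  fviz = Σₗ (concatMap (λ g → map (λ h → X g h) (allFin nH)) (allFin nG)) ⊝ nat (kG ℕ.* kH)

  s : Fin nG → Expr
  s g = Σₗ (map (λ h → X g h) (allFin nH)) ⊝ nat (nH ℕ.∸ 1)

  sumSquares : Expr
  sumSquares = Σₗ (map (λ g → s g ⊗ s g) (allFin nG))

record Graph (V : Set) : Set₁ where
  field
    Adj    : V → V → Set
    sym    : ∀ {u v} → Adj u v → Adj v u
    irrefl : ∀ v → ¬ Adj v v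

module _ {V : Set} (G : Graph V) where
  open Graph G

  Dominating : List V → Set
  Dominating D = ∀ v → v ∈ₗ D ⊎ ∃[ u ] (u ∈ₗ D × Adj u v)

  IsDominationNumber : ℕ → Set
  IsDominationNumber m =
    (∃[ D ] (Unique D × Dominating D × length D ≡ m)) ×
    (∀ D → Unique D → Dominating D → m ℕ.≤ length D)

_□_ : ∀ {A B : Set} → Graph A → Graph B → Graph (A × B)
_□_ {A} {B} G H = record { Adj = adj ; sym = sy ; irrefl = irr }
  where
  module G = Graph G
  module H = Graph H
  adj : A × B → A × B → Set
  adj (g , h) (g' , h') = (g ≡ g' × H.Adj h h') ⊎ (G.Adj g g' × h ≡ h')
  sy : ∀ {u v} → adj u v → adj v u
  sy (inj₁ (e , a)) = inj₁ (≡-sym e , H.sym a)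
  sy (inj₂ (a , e)) = inj₂ (G.sym a , ≡-sym e)
  irr : ∀ v → ¬ adj v v
  irr (g , h) (inj₁ (_ , a)) = H.irrefl h a
  irr (g , h) (inj₂ (a , _)) = G.irrefl g a

module Submission where

-- I_viz contains v² - v for every variable, so membership
-- can be tested pointwise on {0,1}^V (a Boolean Nullstellensatz): it suffices
-- that at each Boolean point either some generator takes an invertible
-- value, or f_viz - Σ s_g² vanishes.  Generators evaluate to natural
-- numbers, which are invertible in characteristic zero when nonzero.  If all
-- generators vanish, G has no edges (k_G = n_G) and every row of the point
-- has n_H - 1 or n_H ones (k_H = n_H - 1), and then a - (a - M)² = M row by
-- row gives the identity.
--
-- Combinatorial half.  γ(G) = n_G forces G edgeless, so every row of a
-- dominating set of G □ H dominates H and has at least n_H - 1 elements.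

open import Algebra.Bundles using (CommutativeRing)
open import Data.Nat using (ℕ)
open import Data.Fin.Subset using (Subset)
open import Relation.Binary.Definitions using (DecidableEquality)
open import Defs using (module Poly; IsCharZeroField)

-- Integer coefficients let the solver
-- recognise cancellations such as x - x = 0; the tail-optimised n × 1 makes
-- the constants 0 and 1 of the solver definitionally 0# and 1#.
module IntegerSolver {c ℓ} (R : CommutativeRing c ℓ) where
  open import Data.Nat as ℕ using (ℕ; zero; suc)
  import Data.Nat.Properties as ℕ
  open import Data.Integer as ℤ using (ℤ; +_; -[1+_]; _⊖_)
  import Data.Integer.Properties as ℤ
  open import Data.Sign as Sign using (Sign)
  open import Data.Maybe using (just; nothing)
  open import Relation.Binary.PropositionalEquality as ≡ using (_≡_)
  open import Relation.Nullary using (yes; no)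
  open import Algebra.Solver.Ring.AlmostCommutativeRing
    using (fromCommutativeRing; _-Raw-AlmostCommutative⟶_; Induced-equivalence)
  open import Relation.Binary.Definitions using (WeaklyDecidable)

  open CommutativeRing R
  open import Algebra.Properties.Ring ring using (-‿distribˡ-*; -‿distribʳ-*; -‿involutive; -0#≈0#)
  open import Algebra.Properties.AbelianGroup +-abelianGroup using (⁻¹-∙-comm)
  open import Algebra.Properties.CommutativeSemigroup +-commutativeSemigroup using (x∙yz≈y∙xz)
  open import Algebra.Properties.Group +-group using (x≈z//y)
  open import Algebra.Properties.Semiring.Mult.TCOptimised semiring using (_×_; 1+×; ×-homo-+; ×1-homo-*)
  open import Relation.Binary.Reasoning.Setoid setoid

  ⟦_⟧ℤ : ℤ → Carrier
  ⟦ + n      ⟧ℤ = n × 1#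
  ⟦ -[1+ n ] ⟧ℤ = - (suc n × 1#)

  ⊖-+-cancel : ∀ m n → ⟦ m ⊖ n ⟧ℤ + n × 1# ≈ m × 1#
  ⊖-+-cancel m zero = +-identityʳ _
  ⊖-+-cancel zero (suc n) = -‿inverseˡ _
  ⊖-+-cancel (suc m) (suc n) = begin
    ⟦ suc m ⊖ suc n ⟧ℤ + suc n × 1#     ≡⟨ ≡.cong (λ i → ⟦ i ⟧ℤ + _) (ℤ.[1+m]⊖[1+n]≡m⊖n m n) ⟩
    ⟦ m ⊖ n ⟧ℤ + suc n × 1#             ≈⟨ +-congˡ (1+× n 1#) ⟩
    ⟦ m ⊖ n ⟧ℤ + (1# + n × 1#)          ≈⟨ x∙yz≈y∙xz _ _ _ ⟩
    1# + (⟦ m ⊖ n ⟧ℤ + n × 1#)          ≈⟨ +-congˡ (⊖-+-cancel m n) ⟩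
    1# + m × 1#                         ≈⟨ 1+× m 1# ⟨
    suc m × 1#                          ∎

  ⊖-homo : ∀ m n → ⟦ m ⊖ n ⟧ℤ ≈ m × 1# - n × 1#
  ⊖-homo m n = x≈z//y _ _ _ (⊖-+-cancel m n)

  +-homo : ∀ i j → ⟦ i ℤ.+ j ⟧ℤ ≈ ⟦ i ⟧ℤ + ⟦ j ⟧ℤ
  +-homo (+ m)    (+ n)    = ×-homo-+ 1# m n
  +-homo (+ m)    -[1+ n ] = ⊖-homo m (suc n)
  +-homo -[1+ m ] (+ n)    = trans (⊖-homo n (suc m)) (+-comm _ _)
  +-homo -[1+ m ] -[1+ n ] = begin
    - (suc (suc (m ℕ.+ n)) × 1#)       ≡⟨ ≡.cong (λ k → - (suc k × 1#)) (ℕ.+-suc m n) ⟨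
    - ((suc m ℕ.+ suc n) × 1#)         ≈⟨ -‿cong (×-homo-+ 1# (suc m) (suc n)) ⟩
    - (suc m × 1# + suc n × 1#)        ≈⟨ ⁻¹-∙-comm _ _ ⟨
    - (suc m × 1#) + - (suc n × 1#)    ∎

  -‿homo : ∀ i → ⟦ ℤ.- i ⟧ℤ ≈ - ⟦ i ⟧ℤ
  -‿homo (+ zero)  = sym -0#≈0#
  -‿homo (+ suc n) = refl
  -‿homo -[1+ n ]  = sym (-‿involutive _)

  -- multiplication of integers goes through sign and absolute value
  applySign : Sign → Carrier → Carrier
  applySign Sign.+ x = x
  applySign Sign.- x = - x

  ◃-homo : ∀ s n → ⟦ s ℤ.◃ n ⟧ℤ ≈ applySign s (n × 1#)
  ◃-homo Sign.+ zero    = refl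
  ◃-homo Sign.- zero    = sym -0#≈0#
  ◃-homo Sign.+ (suc n) = refl
  ◃-homo Sign.- (suc n) = refl

  *-homo : ∀ i j → ⟦ i ℤ.* j ⟧ℤ ≈ ⟦ i ⟧ℤ * ⟦ j ⟧ℤ
  *-homo (+ m) (+ n) = trans (◃-homo Sign.+ (m ℕ.* n)) (×1-homo-* m n)
  *-homo (+ m) -[1+ n ] = begin
    ⟦ Sign.- ℤ.◃ m ℕ.* suc n ⟧ℤ      ≈⟨ ◃-homo Sign.- (m ℕ.* suc n) ⟩
    - ((m ℕ.* suc n) × 1#)           ≈⟨ -‿cong (×1-homo-* m (suc n)) ⟩
    - (m × 1# * suc n × 1#)          ≈⟨ -‿distribʳ-* _ _ ⟩
    m × 1# * - (suc n × 1#)          ∎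
  *-homo -[1+ m ] (+ n) = begin
    ⟦ Sign.- ℤ.◃ suc m ℕ.* n ⟧ℤ      ≈⟨ ◃-homo Sign.- (suc m ℕ.* n) ⟩
    - ((suc m ℕ.* n) × 1#)           ≈⟨ -‿cong (×1-homo-* (suc m) n) ⟩
    - (suc m × 1# * n × 1#)          ≈⟨ -‿distribˡ-* _ _ ⟩
    - (suc m × 1#) * n × 1#          ∎
  *-homo -[1+ m ] -[1+ n ] = begin
    (suc m ℕ.* suc n) × 1#                ≈⟨ ×1-homo-* (suc m) (suc n) ⟩
    suc m × 1# * suc n × 1#               ≈⟨ -‿involutive _ ⟨
    - - (suc m × 1# * suc n × 1#)         ≈⟨ -‿cong (-‿distribˡ-* _ _) ⟩
    - (- (suc m × 1#) * suc n × 1#)       ≈⟨ -‿distribʳ-* _ _ ⟩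
    - (suc m × 1#) * - (suc n × 1#)       ∎

  ℤ-homomorphism : ℤ.+-*-rawRing -Raw-AlmostCommutative⟶ fromCommutativeRing R
  ℤ-homomorphism = record
    { ⟦_⟧ = ⟦_⟧ℤ ; +-homo = +-homo ; *-homo = *-homo ; -‿homo = -‿homo
    ; 0-homo = refl ; 1-homo = refl }

  -- equal integers have equal images (all the solver needs to know)
  _≟ℤ_ : WeaklyDecidable (Induced-equivalence ℤ-homomorphism)
  i ≟ℤ j with i ℤ.≟ j
  ... | yes ≡.refl = just refl
  ... | no _ = nothing

  open import Algebra.Solver.Ring ℤ.+-*-rawRing (fromCommutativeRing R) ℤ-homomorphism _≟ℤ_ public
    using (solve; _:=_; _:+_; _:*_; :-_; _:-_) renaming (con to const)

-- Polynomial expressions modulo the commutative-algebra laws form a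
-- commutative ring; this is what lets us run the ring solver on them.
module PolynomialRing {c ℓ} (R : CommutativeRing c ℓ) (V : Set) where
  open import Defs using (module Poly)
  open import Level using (_⊔_)
  open import Algebra.Structures using (IsCommutativeRing)
  open import Data.Product using (_,_)

  open Poly R V
  open CommutativeRing R using (0#; 1#)

  ⊕-identityʳ : ∀ p → p ⊕ con 0# ≋ p
  ⊕-identityʳ p = ≋-trans (⊕-comm p _) (⊕-identityˡ p)

  ⊕-inverseʳ : ∀ p → p ⊕ ⊖ p ≋ con 0#
  ⊕-inverseʳ p = ≋-trans (⊕-comm p _) (⊕-inverseˡ p)

  ⊗-identityʳ : ∀ p → p ⊗ con 1# ≋ p
  ⊗-identityʳ p = ≋-trans (⊗-comm p _) (⊗-identityˡ p)

  distribʳ : ∀ p q r → (q ⊕ r) ⊗ p ≋ q ⊗ p ⊕ r ⊗ p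
  distribʳ p q r =
    ≋-trans (⊗-comm _ _) (≋-trans (distribˡ p q r) (⊕-cong (⊗-comm _ _) (⊗-comm _ _)))

  isCommutativeRing : IsCommutativeRing _≋_ _⊕_ _⊗_ ⊖_ (con 0#) (con 1#)
  isCommutativeRing = record
    { isRing = record
      { +-isAbelianGroup = record
        { isGroup = record
          { isMonoid = record
            { isSemigroup = record
              { isMagma = record
                { isEquivalence = record { refl = ≋-refl ; sym = ≋-sym ; trans = ≋-trans }
                ; ∙-cong = ⊕-cong }
              ; assoc = ⊕-assoc }
            ; identity = ⊕-identityˡ , ⊕-identityʳ }
          ; inverse = ⊕-inverseˡ , ⊕-inverseʳ
          ; ⁻¹-cong = ⊖-cong }
        ; comm = ⊕-comm }
      ; *-cong = ⊗-cong
      ; *-assoc = ⊗-assoc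
      ; *-identity = ⊗-identityˡ , ⊗-identityʳ
      ; distrib = distribˡ , distribʳ }
    ; *-comm = ⊗-comm }

  polynomialRing : CommutativeRing c (c ⊔ ℓ)
  polynomialRing = record { isCommutativeRing = isCommutativeRing }

-- The proof splits 1 into the indicator monomials
-- δ_c of the Boolean points c: modulo I, δ_c · q ≡ q(c) · δ_c.
module BooleanNullstellensatz {c ℓ} (R : CommutativeRing c ℓ) {V : Set}
         (_≟V_ : DecidableEquality V) {Ix : Set} (gens : Ix → Poly.Expr R V) where
  open import Defs using (module Poly)
  open import Level using (_⊔_)
  open import Data.Bool using (Bool; true; false)
  open import Data.Integer using (+_)
  open import Data.List using (List; []; _∷_; _++_; [_])
  open import Data.List.Properties using (++-assoc)
  open import Data.List.Relation.Unary.Any using (Any; here; there)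
  open import Data.List.Relation.Unary.Any.Properties using (++⁺ʳ)
  open import Data.List.Membership.Propositional using (_∈_)
  open import Data.Product using (_×_; _,_; proj₁; Σ; ∃-syntax)
  open import Data.Sum using (_⊎_; inj₁; inj₂)
  open import Relation.Binary.Bundles using (Setoid)
  open import Relation.Binary.PropositionalEquality as ≡ using (_≡_)
  open import Relation.Nullary using (yes; no)
  open import Relation.Nullary.Negation using (contradiction)

  open Poly R V
  open PolynomialRing R V using (polynomialRing; distribʳ)
  open IntegerSolver polynomialRing using (solve; _:=_; _:+_; _:*_; :-_; _:-_; const)
  module R = CommutativeRing R
  open R using (Carrier; 0#; 1#)

  I : Expr → Set (c ⊔ ℓ)
  I = InIdeal gens

  one : Expr
  one = con 1#

  infix 4 _~_
  _~_ : Expr → Expr → Set (c ⊔ ℓ)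
  p ~ q = I (p ⊝ q)

  I-⊖ : ∀ {p} → I p → I (⊖ p)
  I-⊖ {p} h = resp (solve 1 (λ p → :- const (+ 1) :* p := :- p) ≋-refl p) (mul (⊖ one) h)

  ≋⇒~ : ∀ {p q} → p ≋ q → p ~ q
  ≋⇒~ {p} {q} e =
    resp (≋-trans (solve 1 (λ q → const (+ 0) := q :- q) ≋-refl q) (⊕-cong (≋-sym e) ≋-refl)) zero

  ~-sym : ∀ {p q} → p ~ q → q ~ p
  ~-sym {p} {q} h = resp (solve 2 (λ p q → :- (p :- q) := q :- p) ≋-refl p q) (I-⊖ h)

  ~-trans : ∀ {p q r} → p ~ q → q ~ r → p ~ r
  ~-trans {p} {q} {r} h h' =
    resp (solve 3 (λ p q r → (p :- q) :+ (q :- r) := p :- r) ≋-refl p q r) (add h h')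

  ~-setoid : Setoid c (c ⊔ ℓ)
  ~-setoid = record
    { _≈_ = _~_
    ; isEquivalence = record { refl = ≋⇒~ ≋-refl ; sym = ~-sym ; trans = ~-trans } }

  ~-⊕ : ∀ {p p' q q'} → p ~ p' → q ~ q' → p ⊕ q ~ p' ⊕ q'
  ~-⊕ {p} {p'} {q} {q'} h h' = resp
    (solve 4 (λ p p' q q' → (p :- p') :+ (q :- q') := (p :+ q) :- (p' :+ q')) ≋-refl p p' q q')
    (add h h')

  ~-⊗ˡ : ∀ r {p q} → p ~ q → r ⊗ p ~ r ⊗ q
  ~-⊗ˡ r {p} {q} h = resp (solve 3 (λ r p q → r :* (p :- q) := r :* p :- r :* q) ≋-refl r p q) (mul r h)

  ~-⊗ʳ : ∀ r {p q} → p ~ q → p ⊗ r ~ q ⊗ r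
  ~-⊗ʳ r {p} {q} h = resp (solve 3 (λ r p q → r :* (p :- q) := p :* r :- q :* r) ≋-refl r p q) (mul r h)

  ~-⊖ : ∀ {p q} → p ~ q → ⊖ p ~ ⊖ q
  ~-⊖ {p} {q} h = resp (solve 2 (λ p q → :- (p :- q) := :- p :- :- q) ≋-refl p q) (I-⊖ h)

  I-resp-~ : ∀ {p q} → p ~ q → I q → I p
  I-resp-~ {p} {q} h i = resp (solve 2 (λ p q → (p :- q) :+ q := p) ≋-refl p q) (add h i)

  I-unit : ∀ {a y q} → a R.* y R.≈ 1# → I (con a ⊗ q) → I q
  I-unit {a} {y} {q} ay≈1 h = resp (begin
    con y ⊗ (con a ⊗ q)      ≈⟨ ⊗-assoc _ _ _ ⟨
    (con y ⊗ con a) ⊗ q      ≈⟨ ⊗-cong (con-* y a) ≋-refl ⟨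
    con (y R.* a) ⊗ q        ≈⟨ ⊗-cong (con-cong (R.trans (R.*-comm y a) ay≈1)) ≋-refl ⟩
    con 1# ⊗ q               ≈⟨ ⊗-identityˡ q ⟩
    q                        ∎) (mul (con y) h)
    where open import Relation.Binary.Reasoning.Setoid (CommutativeRing.setoid polynomialRing)

  bool : Bool → Carrier
  bool true  = 1#
  bool false = 0#

  eval : (V → Bool) → Expr → Carrier
  eval b (con k) = k
  eval b (var v) = bool (b v)
  eval b (p ⊕ q) = eval b p R.+ eval b q
  eval b (p ⊗ q) = eval b p R.* eval b q
  eval b (⊖ p)   = R.- eval b p

  eval-Σₗ-++ : ∀ b xs ys → eval b (Σₗ (xs ++ ys)) R.≈ eval b (Σₗ xs) R.+ eval b (Σₗ ys)
  eval-Σₗ-++ b []       ys = R.sym (R.+-identityˡ _)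
  eval-Σₗ-++ b (p ∷ xs) ys = R.trans (R.+-congˡ (eval-Σₗ-++ b xs ys)) (R.sym (R.+-assoc _ _ _))

  -- A partial Boolean point is a list of literals; the first literal on a
  -- variable wins.  Its indicator is the product of v or 1 - v.
  Literal : Set
  Literal = V × Bool

  literal : Literal → Expr
  literal (v , true)  = var v
  literal (v , false) = one ⊝ var v

  indicator : List Literal → Expr
  indicator []      = one
  indicator (l ∷ c) = literal l ⊗ indicator c

  valueOf : List Literal → V → Bool
  valueOf []            v = false
  valueOf ((w , t) ∷ c) v with w ≟V v
  ... | yes _ = t
  ... | no  _ = valueOf c v

  Assigns : List Literal → V → Set
  Assigns c v = Any (λ l → proj₁ l ≡ v) c

  indicator-factor : ∀ {v} c → Assigns c v →
    Σ (List Literal) λ c' → indicator c ≋ literal (v , valueOf c v) ⊗ indicator c'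
  indicator-factor {v} ((w , t) ∷ c) a with w ≟V v
  ... | yes ≡.refl = c , ≋-refl
  indicator-factor {v} ((w , t) ∷ c) (here w≡v) | no w≢v = contradiction w≡v w≢v
  indicator-factor {v} ((w , t) ∷ c) (there a)  | no w≢v with indicator-factor c a
  ... | c' , e = ((w , t) ∷ c') , ≋-trans (⊗-cong ≋-refl e)
        (solve 3 (λ a l d → a :* (l :* d) := l :* (a :* d)) ≋-refl (literal (w , t)) (literal (v , valueOf c v)) (indicator c'))

  module _ (idempotent : ∀ v → I (var v ⊗ var v ⊝ var v)) where
    open import Relation.Binary.Reasoning.Setoid ~-setoid

    literal-absorbs : ∀ v t → literal (v , t) ⊗ var v ~ con (bool t) ⊗ literal (v , t)
    literal-absorbs v true  = ~-trans (idempotent v) (≋⇒~ (≋-sym (⊗-identityˡ _)))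
    literal-absorbs v false = resp
      (solve 1 (λ v → :- (v :* v :- v) := (const (+ 1) :- v) :* v :- const (+ 0) :* (const (+ 1) :- v)) ≋-refl (var v))
      (I-⊖ (idempotent v))

    con-⊖ : ∀ a → con (R.- a) ≋ ⊖ con a
    con-⊖ a = inverseˡ-unique _ _ (≋-trans (≋-sym (con-+ _ _)) (con-cong (R.-‿inverseˡ a)))
      where open import Algebra.Properties.Group (CommutativeRing.+-group polynomialRing) using (inverseˡ-unique)

    Total : List Literal → Set
    Total c = ∀ v → Assigns c v

    module _ (c : List Literal) (total : Total c) where
      private
        δ : Expr
        δ = indicator c
        b : V → Bool
        b = valueOf c

      indicator-evaluates : ∀ q → δ ⊗ q ~ con (eval b q) ⊗ δ
      indicator-evaluates (con k) = ≋⇒~ (⊗-comm _ _)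
      indicator-evaluates (var v) with indicator-factor c (total v)
      ... | c' , e = begin
        δ ⊗ var v                           ≈⟨ ≋⇒~ (⊗-cong e ≋-refl) ⟩
        (L ⊗ indicator c') ⊗ var v          ≈⟨ ≋⇒~ (solve 3 (λ l d x → (l :* d) :* x := (l :* x) :* d) ≋-refl L (indicator c') (var v)) ⟩
        (L ⊗ var v) ⊗ indicator c'          ≈⟨ ~-⊗ʳ (indicator c') (literal-absorbs v (b v)) ⟩
        (con (bool (b v)) ⊗ L) ⊗ indicator c'   ≈⟨ ≋⇒~ (⊗-assoc _ _ _) ⟩
        con (bool (b v)) ⊗ (L ⊗ indicator c')   ≈⟨ ≋⇒~ (⊗-cong ≋-refl (≋-sym e)) ⟩
        con (bool (b v)) ⊗ δ                ∎
        where
        L : Expr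
        L = literal (v , b v)
      indicator-evaluates (p ⊕ q) = begin
        δ ⊗ (p ⊕ q)                               ≈⟨ ≋⇒~ (distribˡ _ _ _) ⟩
        δ ⊗ p ⊕ δ ⊗ q                             ≈⟨ ~-⊕ (indicator-evaluates p) (indicator-evaluates q) ⟩
        con (eval b p) ⊗ δ ⊕ con (eval b q) ⊗ δ   ≈⟨ ≋⇒~ (≋-sym (distribʳ _ _ _)) ⟩
        (con (eval b p) ⊕ con (eval b q)) ⊗ δ     ≈⟨ ≋⇒~ (⊗-cong (≋-sym (con-+ _ _)) ≋-refl) ⟩
        con (eval b (p ⊕ q)) ⊗ δ                  ∎
      indicator-evaluates (p ⊗ q) = begin
        δ ⊗ (p ⊗ q)                               ≈⟨ ≋⇒~ (≋-sym (⊗-assoc _ _ _)) ⟩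
        (δ ⊗ p) ⊗ q                               ≈⟨ ~-⊗ʳ q (indicator-evaluates p) ⟩
        (con (eval b p) ⊗ δ) ⊗ q                  ≈⟨ ≋⇒~ (⊗-assoc _ _ _) ⟩
        con (eval b p) ⊗ (δ ⊗ q)                  ≈⟨ ~-⊗ˡ _ (indicator-evaluates q) ⟩
        con (eval b p) ⊗ (con (eval b q) ⊗ δ)     ≈⟨ ≋⇒~ (≋-sym (⊗-assoc _ _ _)) ⟩
        (con (eval b p) ⊗ con (eval b q)) ⊗ δ     ≈⟨ ≋⇒~ (⊗-cong (≋-sym (con-* _ _)) ≋-refl) ⟩
        con (eval b (p ⊗ q)) ⊗ δ                  ∎
      indicator-evaluates (⊖ p) = begin
        δ ⊗ ⊖ p                   ≈⟨ ≋⇒~ (solve 2 (λ d p → d :* (:- p) := :- (d :* p)) ≋-refl δ p) ⟩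
        ⊖ (δ ⊗ p)                 ≈⟨ ~-⊖ (indicator-evaluates p) ⟩
        ⊖ (con (eval b p) ⊗ δ)    ≈⟨ ≋⇒~ (solve 2 (λ a d → :- (a :* d) := (:- a) :* d) ≋-refl (con (eval b p)) δ) ⟩
        ⊖ con (eval b p) ⊗ δ      ≈⟨ ≋⇒~ (⊗-cong (≋-sym (con-⊖ _)) ≋-refl) ⟩
        con (eval b (⊖ p)) ⊗ δ    ∎

    module _ (p : Expr)
      (separates : ∀ (b : V → Bool) →
         (Σ Ix λ j → ∃[ y ] eval b (gens j) R.* y R.≈ 1#) ⊎ eval b p R.≈ 0#) where

      Killed : List Literal → Set (c ⊔ ℓ)
      Killed c = I (indicator c ⊗ p)

      -- at a total point: either δ_c is a unit multiple of a generator
      -- value, or p(c) = 0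
      killed-total : ∀ c → Total c → Killed c
      killed-total c total with separates (valueOf c)
      ... | inj₁ (j , y , gy≈1) = resp (⊗-comm _ _) (mul p (I-unit gy≈1 g∙δ∈I))
        where
        g∙δ∈I : I (con (eval (valueOf c) (gens j)) ⊗ indicator c)
        g∙δ∈I = I-resp-~ (~-sym (indicator-evaluates c total (gens j))) (mul (indicator c) (gen j))
      ... | inj₂ p≈0 = I-resp-~ (begin
        indicator c ⊗ p                      ≈⟨ indicator-evaluates c total p ⟩
        con (eval (valueOf c) p) ⊗ indicator c  ≈⟨ ≋⇒~ (⊗-cong (con-cong p≈0) ≋-refl) ⟩
        con 0# ⊗ indicator c                 ≈⟨ ≋⇒~ (solve 1 (λ d → const (+ 0) :* d := const (+ 0)) ≋-refl (indicator c)) ⟩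
        con 0# ∎) zero

      -- δ_c = v · δ_c + (1 - v) · δ_c: split on a variable
      killed-split : ∀ w c → Killed ((w , true) ∷ c) → Killed ((w , false) ∷ c) → Killed c
      killed-split w c h h' = resp
        (solve 3 (λ x d p → (x :* d) :* p :+ ((const (+ 1) :- x) :* d) :* p := d :* p) ≋-refl (var w) (indicator c) p)
        (add h h')

      Covers : List V → List Literal → Set
      Covers ws c = ∀ v → v ∈ ws → Assigns c v

      killed-extend : ∀ ws c → (∀ d → Covers ws (d ++ c) → Killed (d ++ c)) → Killed c
      killed-extend []       c H = H [] (λ _ ())
      killed-extend (w ∷ ws) c H = killed-split w c (branch true) (branch false)
        where
        branch : ∀ t → Killed ((w , t) ∷ c)
        branch t = killed-extend ws ((w , t) ∷ c) λ d cov →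
          ≡.subst Killed (++-assoc d [ w , t ] c)
            (H (d ++ [ w , t ]) (≡.subst (Covers (w ∷ ws)) (≡.sym (++-assoc d [ w , t ] c)) (covers d cov)))
          where
          covers : ∀ d → Covers ws (d ++ (w , t) ∷ c) → Covers (w ∷ ws) (d ++ (w , t) ∷ c)
          covers d cov v (here ≡.refl) = ++⁺ʳ d (here ≡.refl)
          covers d cov v (there v∈ws)  = cov v v∈ws

      nullstellensatz : (vars : List V) → (∀ v → v ∈ vars) → I p
      nullstellensatz vars complete = resp (⊗-identityˡ p)
        (killed-extend vars [] λ d cov → killed-total (d ++ []) λ v → cov v (complete v))

module Counting where
  open import Defs using (elems)
  open import Data.Bool using (Bool; true; false)
  open import Data.Nat as ℕ using (ℕ; zero; suc; _≤_; z≤n; s≤s; _∸_)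
  import Data.Nat.Properties as ℕ
  open import Data.Nat.ListAction using (sum; product)
  open import Data.Fin as Fin using (Fin)
  open import Data.Fin.Subset using (Subset; _∈_; _⊆_; ∣_∣; ⊤; inside; outside)
  open import Data.Fin.Subset.Properties using (_∈?_; ⊆-refl; s⊆s; ⊆⊤; ∣⊤∣≡n)
  open import Data.Vec as Vec using ([]; _∷_)
  open import Data.List as List using (List; []; _∷_; map; allFin)
  import Data.List.Properties as List
  open import Data.List.Relation.Unary.Any using (here; there)
  open import Data.List.Membership.Propositional using () renaming (_∈_ to _∈ₗ_)
  open import Data.List.Membership.Propositional.Properties using (∈-allFin; ∈-filter⁺; ∈-filter⁻)
  open import Data.Product using (_×_; _,_; ∃-syntax; proj₂)
  open import Data.Sum using (inj₁; inj₂)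
  open import Relation.Binary.PropositionalEquality as ≡ using (_≡_; _≢_; refl; cong)
  open import Relation.Nullary using (yes; no)

  bit : Bool → ℕ
  bit true  = 1
  bit false = 0

  bit≤1 : ∀ t → bit t ≤ 1
  bit≤1 true  = s≤s z≤n
  bit≤1 false = z≤n

  module _ {A : Set} where
    product-zero : ∀ (l : List A) f → product (map f l) ≡ 0 → ∃[ a ] (a ∈ₗ l × f a ≡ 0)
    product-zero (a ∷ l) f e with ℕ.m*n≡0⇒m≡0∨n≡0 (f a) e
    ... | inj₁ fa≡0 = a , here refl , fa≡0
    ... | inj₂ rest≡0 with product-zero l f rest≡0
    ...   | a' , a'∈l , fa'≡0 = a' , there a'∈l , fa'≡0

    product-nonzero : ∀ (l : List A) f → (∀ a → a ∈ₗ l → f a ≢ 0) → product (map f l) ≢ 0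
    product-nonzero l f nz e with product-zero l f e
    ... | a , a∈l , fa≡0 = nz a a∈l fa≡0

    sum-nonzero : ∀ (l : List A) f {a} → a ∈ₗ l → f a ≢ 0 → sum (map f l) ≢ 0
    sum-nonzero (b ∷ l) f (here refl) nz e = nz (ℕ.m+n≡0⇒m≡0 (f b) e)
    sum-nonzero (b ∷ l) f (there a∈l) nz e = sum-nonzero l f a∈l nz (ℕ.m+n≡0⇒n≡0 (f b) e)

  complement-zero : ∀ {m} t → m ≤ 1 → 1 ∸ m ℕ.* bit t ≡ 0 → m ≡ 1 × t ≡ true
  complement-zero {suc zero} true  _ _ = refl , refl
  complement-zero {suc zero} false _ ()
  complement-zero {zero}     t     _ ()
  complement-zero {suc (suc _)} _ (s≤s ()) _

  ∈-elems⁺ : ∀ {n} {S : Subset n} {i} → i ∈ S → i ∈ₗ elems S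
  ∈-elems⁺ {S = S} {i} i∈S = ∈-filter⁺ (_∈? S) (∈-allFin i) i∈S

  ∈-elems⁻ : ∀ {n} {S : Subset n} {i} → i ∈ₗ elems S → i ∈ S
  ∈-elems⁻ {n} {S} i∈ = proj₂ (∈-filter⁻ (_∈? S) {xs = allFin n} i∈)

  sum-bits : ∀ {n} (f : Fin n → Bool) → sum (map (λ i → bit (f i)) (allFin n)) ≡ ∣ Vec.tabulate f ∣
  sum-bits f = ≡.trans (cong sum (List.map-tabulate (λ i → i) (λ i → bit (f i)))) (go f)
    where
    go : ∀ {n} (f : Fin n → Bool) → sum (List.tabulate (λ i → bit (f i))) ≡ ∣ Vec.tabulate f ∣
    go {zero}  f = refl
    go {suc n} f with f Fin.zero
    ... | true  = cong suc (go (λ i → f (Fin.suc i)))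
    ... | false = go (λ i → f (Fin.suc i))

  enlarge : ∀ {n} (T : Subset n) {k} → ∣ T ∣ ≤ k → k ≤ n → ∃[ S ] (T ⊆ S × ∣ S ∣ ≡ k)
  enlarge [] {zero} _ _ = [] , ⊆-refl , refl
  enlarge (inside ∷ T) {suc k} (s≤s ∣T∣≤k) (s≤s k≤n) with enlarge T ∣T∣≤k k≤n
  ... | S , T⊆S , ∣S∣≡k = inside ∷ S , s⊆s T⊆S , cong suc ∣S∣≡k
  enlarge {suc n} (outside ∷ T) {k} ∣T∣≤k k≤1+n with k ℕ.≤? n
  ... | yes k≤n with enlarge T ∣T∣≤k k≤n
  ...   | S , T⊆S , ∣S∣≡k = outside ∷ S , s⊆s T⊆S , ∣S∣≡k
  enlarge {suc n} (outside ∷ T) {k} ∣T∣≤k k≤1+n | no k≰n =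
    ⊤ , ⊆⊤ , ≡.trans (∣⊤∣≡n (suc n)) (ℕ.≤-antisym (ℕ.≰⇒> k≰n) k≤1+n)

module VizingVariables (nG nH : ℕ) where
  open import Defs using (VizVar; eG; eH; x)
  open import Data.Fin as Fin using (Fin)
  open import Data.Fin.Properties using (_<?_)
  open import Data.List using (List; []; map; allFin; _++_; concat; cartesianProduct; [_])
  open import Data.List.Relation.Unary.Any using (here)
  open import Data.List.Membership.Propositional using () renaming (_∈_ to _∈ₗ_)
  open import Data.List.Membership.Propositional.Properties
    using (∈-++⁺ˡ; ∈-++⁺ʳ; ∈-concat⁺′; ∈-map⁺; ∈-cartesianProduct⁺; ∈-allFin)
  open import Data.Product using (_×_; _,_; uncurry)
  import Data.Product.Properties as Product
  open import Relation.Binary.Definitions using (DecidableEquality)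
  open import Relation.Binary.PropositionalEquality using (refl)
  open import Relation.Nullary using (yes; no)
  open import Relation.Nullary.Decidable using (map′; recompute)
  open import Relation.Nullary.Negation using (contradiction)

  Var : Set
  Var = VizVar nG nH

  _≟V_ : DecidableEquality Var
  eG g g' _ ≟V eG h h' _ = map′ (λ { refl → refl }) (λ { refl → refl }) (Product.≡-dec Fin._≟_ Fin._≟_ (g , g') (h , h'))
  eH g g' _ ≟V eH h h' _ = map′ (λ { refl → refl }) (λ { refl → refl }) (Product.≡-dec Fin._≟_ Fin._≟_ (g , g') (h , h'))
  x g h     ≟V x g' h'   = map′ (λ { refl → refl }) (λ { refl → refl }) (Product.≡-dec Fin._≟_ Fin._≟_ (g , h) (g' , h'))
  eG _ _ _ ≟V eH _ _ _ = no λ ()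
  eG _ _ _ ≟V x _ _    = no λ ()
  eH _ _ _ ≟V eG _ _ _ = no λ ()
  eH _ _ _ ≟V x _ _    = no λ ()
  x _ _    ≟V eG _ _ _ = no λ ()
  x _ _    ≟V eH _ _ _ = no λ ()

  orderedPair : ∀ {m} → ((i j : Fin m) → .(i Fin.< j) → Var) → Fin m × Fin m → List Var
  orderedPair e (i , j) with i <? j
  ... | yes i<j = [ e i j i<j ]
  ... | no  _   = []

  orderedPairs : ∀ m → ((i j : Fin m) → .(i Fin.< j) → Var) → List Var
  orderedPairs m e = concat (map (orderedPair e) (cartesianProduct (allFin m) (allFin m)))

  ∈-orderedPairs : ∀ {m} e (i j : Fin m) .(i<j : i Fin.< j) → e i j i<j ∈ₗ orderedPairs m e
  ∈-orderedPairs e i j i<j = ∈-concat⁺′ ∈-pair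
    (∈-map⁺ (orderedPair e) (∈-cartesianProduct⁺ (∈-allFin i) (∈-allFin j)))
    where
    ∈-pair : e i j i<j ∈ₗ orderedPair e (i , j)
    ∈-pair with i <? j
    ... | yes _   = here refl
    ... | no  i≮j = contradiction (recompute (i <? j) i<j) i≮j

  allVars : List Var
  allVars = orderedPairs nG eG ++ orderedPairs nH eH
         ++ map (uncurry x) (cartesianProduct (allFin nG) (allFin nH))

  ∈-allVars : ∀ v → v ∈ₗ allVars
  ∈-allVars (eG g g' g<g') = ∈-++⁺ˡ (∈-orderedPairs eG g g' g<g')
  ∈-allVars (eH h h' h<h') = ∈-++⁺ʳ (orderedPairs nG eG) (∈-++⁺ˡ (∈-orderedPairs eH h h' h<h'))
  ∈-allVars (x g h) = ∈-++⁺ʳ (orderedPairs nG eG) (∈-++⁺ʳ (orderedPairs nH eH)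
    (∈-map⁺ (uncurry x) (∈-cartesianProduct⁺ (∈-allFin g) (∈-allFin h))))

-- By the Boolean Nullstellensatz it suffices to
-- check every Boolean point b: either some generator of I_viz does not
-- vanish at b, or b is the indicator of a dominating set of G □ H of the
-- expected shape (G edgeless, every row of size n_H - 1 or n_H), where the
-- certificate identity holds numerically.
module VizingCertificate {c ℓ} (K : CommutativeRing c ℓ) (charZero : IsCharZeroField K)
         (nG nH : ℕ) (DG : Subset nG) (DH : Subset nH) where
  open import Defs
  open import Algebra.Bundles using (CommutativeRing)
  open import Data.Bool using (Bool; true; false)
  open import Data.Integer using (+_)
  open import Data.Nat as ℕ using (ℕ; zero; suc; _≤_; _<_; z≤n; s≤s; _∸_)
  import Data.Nat.Properties as ℕ
  open import Data.Nat.ListAction using (sum; product)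
  open import Data.Fin as Fin using (Fin)
  open import Data.Fin.Properties using (_<?_; <-cmp; <-irrefl; <-asym; any?; all?; ¬∀⟶∃¬)
  open import Data.Fin.Subset using (Subset; _∈_; _∉_; ∣_∣; ∁; ⁅_⁆)
  open import Data.Fin.Subset.Properties
    using (∣p∣≤n; ∣∁p∣≡n∸∣p∣; ∣⁅x⁆∣≡1; x∈∁p⇒x∉p; x∉∁p⇒x∈p; x∈⁅y⁆⇒x≡y; x∉p⇒x∈∁p)
  import Data.Vec as Vec
  import Data.Vec.Properties as Vec
  open import Data.List using (List; []; _∷_; map; allFin; concat; length)
  import Data.List.Properties as List
  open import Data.Product using (_×_; _,_; ∃-syntax; Σ)
  open import Data.Sum using (_⊎_; inj₁; inj₂)
  open import Relation.Binary.Definitions using (tri<; tri≈; tri>)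
  open import Relation.Binary.PropositionalEquality as ≡ using (_≡_; _≢_; refl; cong)
  open import Relation.Nullary using (yes; no; ¬?)
  open import Relation.Nullary.Decidable using (recompute; decidable-stable)
  open import Relation.Nullary.Negation using (contradiction)

  open Viz K nG nH DG DH
  open VizingVariables nG nH using (Var; _≟V_; allVars; ∈-allVars)
  open BooleanNullstellensatz K _≟V_ gens using (bool; eval; eval-Σₗ-++; nullstellensatz)
  open Counting
  module K = CommutativeRing K
  open K using (Carrier; _≈_; 0#; 1#; _+_; _*_; -_; _-_)
  open IntegerSolver K using (solve; _:=_; _:+_; _:*_; :-_; _:-_; const)
  open import Algebra.Properties.Semiring.Mult (CommutativeRing.semiring K) using (×-homo-+; ×1-homo-*) renaming (_×_ to _×ₖ_)

  -- the image natK n of a natural number is the library's n × 1#, so it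
  -- is additive and multiplicative
  natK≡× : ∀ n → natK K n ≡ n ×ₖ 1#
  natK≡× zero    = refl
  natK≡× (suc n) = cong (λ k → 1# + k) (natK≡× n)

  natK-+ : ∀ m n → natK K (m ℕ.+ n) ≈ natK K m + natK K n
  natK-+ m n rewrite natK≡× (m ℕ.+ n) | natK≡× m | natK≡× n = ×-homo-+ 1# m n

  natK-* : ∀ m n → natK K (m ℕ.* n) ≈ natK K m * natK K n
  natK-* m n rewrite natK≡× (m ℕ.* n) | natK≡× m | natK≡× n = ×1-homo-* m n

  idempotent : ∀ v → Iviz (var v ⊗ var v ⊝ var v)
  idempotent (eG g g' g<g') = gen (idemG g g' (recompute (g <? g') g<g'))
  idempotent (eH h h' h<h') = gen (idemH h h' (recompute (h <? h') h<h'))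
  idempotent (x g h)        = gen (idemX g h)

  positive-invertible : ∀ {e} n → e ≈ natK K (suc n) → ∃[ y ] e * y ≈ 1#
  positive-invertible n e≈n = IsCharZeroField.inverse charZero _
    λ e≈0 → IsCharZeroField.charZero charZero n (K.trans (K.sym e≈n) e≈0)

  excess-cong : ∀ M {a a'} → a ≈ a' → a - (a - M) * (a - M) ≈ a' - (a' - M) * (a' - M)
  excess-cong M e = K.+-cong e (K.-‿cong (K.*-cong (K.+-congʳ e) (K.+-congʳ e)))

  -- a - (a - M)² = M whenever a ∈ {M, M + 1}: each square s_g² is then
  -- exactly the excess of row g over M
  row-identity : ∀ a M → a ≈ M ⊎ a ≈ 1# + M → a - (a - M) * (a - M) ≈ M
  row-identity a M (inj₁ a≈M) = K.trans (excess-cong M a≈M)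
    (solve 1 (λ m → m :- (m :- m) :* (m :- m) := m) K.refl M)
  row-identity a M (inj₂ a≈1+M) = K.trans (excess-cong M a≈1+M)
    (solve 1 (λ m → (const (+ 1) :+ m) :- ((const (+ 1) :+ m) :- m) :* ((const (+ 1) :+ m) :- m) := m) K.refl M)

  module AtPoint (b : Var → Bool) where

    record _↦_ (e : Expr) (n : ℕ) : Set ℓ where
      constructor evaluates
      field value : eval b e ≈ natK K n
    infix 4 _↦_

    ↦-var : ∀ v → var v ↦ bit (b v)
    ↦-var v = evaluates (bool≈bit (b v))
      where
      bool≈bit : ∀ t → bool t ≈ natK K (bit t)
      bool≈bit true  = K.sym (K.+-identityʳ 1#)
      bool≈bit false = K.refl

    ↦-⊕ : ∀ {p q m n} → p ↦ m → q ↦ n → p ⊕ q ↦ m ℕ.+ n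
    ↦-⊕ {m = m} {n} (evaluates p≈m) (evaluates q≈n) = evaluates (K.trans (K.+-cong p≈m q≈n) (K.sym (natK-+ m n)))

    ↦-⊗ : ∀ {p q m n} → p ↦ m → q ↦ n → p ⊗ q ↦ m ℕ.* n
    ↦-⊗ {m = m} {n} (evaluates p≈m) (evaluates q≈n) = evaluates (K.trans (K.*-cong p≈m q≈n) (K.sym (natK-* m n)))

    ↦-complement : ∀ {q n} → q ↦ n → n ≤ 1 → one ⊝ q ↦ 1 ∸ n
    ↦-complement {n = zero} (evaluates q≈0) _ = evaluates (K.trans (K.+-congˡ (K.-‿cong q≈0))
      (solve 0 (const (+ 1) :- const (+ 0) := const (+ 1) :+ const (+ 0)) K.refl))
    ↦-complement {n = suc zero} (evaluates q≈1) _ = evaluates (K.trans (K.+-congˡ (K.-‿cong q≈1))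
      (solve 0 (const (+ 1) :- (const (+ 1) :+ const (+ 0)) := const (+ 0)) K.refl))
    ↦-complement {n = suc (suc _)} _ (s≤s ())

    module _ {A : Set} (f : A → Expr) (n : A → ℕ) (f↦n : ∀ a → f a ↦ n a) where
      ↦-Σ : ∀ l → Σₗ (map f l) ↦ sum (map n l)
      ↦-Σ []      = evaluates K.refl
      ↦-Σ (a ∷ l) = ↦-⊕ (f↦n a) (↦-Σ l)

      ↦-Π : ∀ l → Πₗ (map f l) ↦ product (map n l)
      ↦-Π []      = evaluates (K.sym (K.+-identityʳ 1#))
      ↦-Π (a ∷ l) = ↦-⊗ (f↦n a) (↦-Π l)

    edgeBit : ∀ {m} → ((i j : Fin m) → .(i Fin.< j) → Var) → Fin m → Fin m → ℕ
    edgeBit e i j with <-cmp i j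
    ... | tri< i<j _ _ = bit (b (e i j i<j))
    ... | tri≈ _ _ _   = 0
    ... | tri> _ _ j<i = bit (b (e j i j<i))

    edgeBit≤1 : ∀ {m} e (i j : Fin m) → edgeBit e i j ≤ 1
    edgeBit≤1 e i j with <-cmp i j
    ... | tri< _ _ _ = bit≤1 _
    ... | tri≈ _ _ _ = z≤n
    ... | tri> _ _ _ = bit≤1 _

    edgeBit-diagonal : ∀ {m} e (i : Fin m) → edgeBit e i i ≡ 0
    edgeBit-diagonal e i with <-cmp i i
    ... | tri< i<i _ _ = contradiction i<i (<-irrefl refl)
    ... | tri≈ _ _ _   = refl
    ... | tri> _ _ i<i = contradiction i<i (<-irrefl refl)

    edgeBit-sym : ∀ {m} e (i j : Fin m) → edgeBit e i j ≡ edgeBit e j i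
    edgeBit-sym e i j with <-cmp i j | <-cmp j i
    ... | tri< _ _ _   | tri> _ _ _   = refl
    ... | tri≈ _ _ _   | tri≈ _ _ _   = refl
    ... | tri> _ _ _   | tri< _ _ _   = refl
    ... | tri< i<j _ _ | tri< j<i _ _ = contradiction j<i (<-asym i<j)
    ... | tri< i<j _ _ | tri≈ _ j≡i _ = contradiction i<j (<-irrefl (≡.sym j≡i))
    ... | tri≈ _ i≡j _ | tri< j<i _ _ = contradiction j<i (<-irrefl (≡.sym i≡j))
    ... | tri≈ _ i≡j _ | tri> _ _ i<j = contradiction i<j (<-irrefl i≡j)
    ... | tri> _ _ j<i | tri≈ _ j≡i _ = contradiction j<i (<-irrefl j≡i)
    ... | tri> _ _ j<i | tri> _ _ i<j = contradiction i<j (<-asym j<i)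

    eGb : Fin nG → Fin nG → ℕ
    eGb = edgeBit eG

    eHb : Fin nH → Fin nH → ℕ
    eHb = edgeBit eH

    eGG↦ : ∀ g g' → eGG g g' ↦ eGb g g'
    eGG↦ g g' with <-cmp g g'
    ... | tri< _ _ _ = ↦-var _
    ... | tri≈ _ _ _ = evaluates K.refl
    ... | tri> _ _ _ = ↦-var _

    eHH↦ : ∀ h h' → eHH h h' ↦ eHb h h'
    eHH↦ h h' with <-cmp h h'
    ... | tri< _ _ _ = ↦-var _
    ... | tri≈ _ _ _ = evaluates K.refl
    ... | tri> _ _ _ = ↦-var _

    xbit : Fin nG → Fin nH → ℕ
    xbit g h = bit (b (x g h))

    -- value of the neighbourhood generator of (g, h): 1 iff (g, h) is
    -- neither chosen nor adjacent to a chosen vertex of G □ H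
    nbrValue : Fin nG → Fin nH → ℕ
    nbrValue g h = ((1 ∸ xbit g h) ℕ.* product (map (λ g' → 1 ∸ eGb g g' ℕ.* xbit g' h) (others g)))
                   ℕ.* product (map (λ h' → 1 ∸ eHb h h' ℕ.* xbit g h') (others h))

    nbr↦ : ∀ g h → gens (nbrX g h) ↦ nbrValue g h
    nbr↦ g h = ↦-⊗ (↦-⊗ (↦-complement (↦-var (x g h)) (bit≤1 _))
        (↦-Π _ _ (λ g' → ↦-complement (↦-⊗ (eGG↦ g g') (↦-var (x g' h))) (ℕ.*-mono-≤ (edgeBit≤1 eG g g') (bit≤1 _))) (others g)))
        (↦-Π _ _ (λ h' → ↦-complement (↦-⊗ (eHH↦ h h') (↦-var (x g h'))) (ℕ.*-mono-≤ (edgeBit≤1 eH h h') (bit≤1 _))) (others h))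

    coverValue : ∀ {m} → (Fin m → Fin m → ℕ) → Subset m → ℕ
    coverValue E S = product (map (λ j → sum (map (λ i → E i j) (elems S))) (elems (∁ S)))

    cover↦ : ∀ {m} (E : Fin m → Fin m → Expr) (n : Fin m → Fin m → ℕ) → (∀ i j → E i j ↦ n i j) →
      ∀ S → Πₗ (map (λ j → Σₗ (map (λ i → E i j) (elems S))) (elems (∁ S))) ↦ coverValue n S
    cover↦ E n E↦n S = ↦-Π _ _ (λ j → ↦-Σ _ _ (λ i → E↦n i j) (elems S)) (elems (∁ S))

    row : Fin nG → Subset nH
    row g = Vec.tabulate (λ h → b (x g h))

    rowSum : Fin nG → Expr
    rowSum g = Σₗ (map (λ h → X g h) (allFin nH))

    rowSum↦ : ∀ g → rowSum g ↦ ∣ row g ∣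
    rowSum↦ g = ≡.subst (rowSum g ↦_) (sum-bits (λ h → b (x g h))) (↦-Σ _ _ (λ h → ↦-var (x g h)) (allFin nH))

    ∈-row : ∀ {g h} → b (x g h) ≡ true → h ∈ row g
    ∈-row {g} {h} e = Vec.lookup⇒[]= h (row g) (≡.trans (Vec.lookup∘tabulate _ h) e)

    ∉-row : ∀ {g h} → h ∉ row g → xbit g h ≡ 0
    ∉-row {g} {h} h∉row with b (x g h) in e
    ... | true  = contradiction (∈-row e) h∉row
    ... | false = refl

    NonvanishingGenerator : Set ℓ
    NonvanishingGenerator = ∃[ j ] ∃[ n ] (gens j ↦ n × n ≢ 0)

    module _ (kG≡nG : ∣ DG ∣ ≡ nG) (kH≡nH-1 : ∣ DH ∣ ≡ nH ∸ 1) where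

      -- since k_G = n_G, an edge g₁g₂ of G makes the covering generator of
      -- V(G) ∖ {g₂} nonvanishing: g₂ is covered by g₁
      edge-witness : ∀ g₁ g₂ → eGb g₁ g₂ ≢ 0 → NonvanishingGenerator
      edge-witness g₁ g₂ edge = covG S ∣S∣ , coverValue eGb S , cover↦ eGG eGb eGG↦ S , nonzero
        where
        S : Subset nG
        S = ∁ ⁅ g₂ ⁆
        ∣S∣ : ∣ S ∣ ≡ kG ∸ 1
        ∣S∣ = ≡.trans (∣∁p∣≡n∸∣p∣ ⁅ g₂ ⁆) (≡.cong₂ _∸_ (≡.sym kG≡nG) (∣⁅x⁆∣≡1 g₂))
        g₁∈S : g₁ ∈ S
        g₁∈S = x∉p⇒x∈∁p λ g₁∈⁅g₂⁆ →
          edge (≡.subst (λ g → eGb g₁ g ≡ 0) (x∈⁅y⁆⇒x≡y g₂ g₁∈⁅g₂⁆) (edgeBit-diagonal eG g₁))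
        nonzero : coverValue eGb S ≢ 0
        nonzero = product-nonzero (elems (∁ S)) _ λ g g∈∁S →
          sum-nonzero (elems S) (λ g' → eGb g' g) (∈-elems⁺ g₁∈S)
            (≡.subst (λ g → eGb g₁ g ≢ 0) (≡.sym (x∈⁅y⁆⇒x≡y g₂ (x∉∁p⇒x∈p (x∈∁p⇒x∉p (∈-elems⁻ g∈∁S))))) edge)

      dominated-in-row : (∀ g g' → eGb g g' ≡ 0) → ∀ g h → nbrValue g h ≡ 0 → xbit g h ≡ 0 →
                         ∃[ h' ] (h' ∈ row g × eHb h h' ≡ 1)
      dominated-in-row edgeless g h nbr≡0 x≡0 with ℕ.m*n≡0⇒m≡0∨n≡0 _ nbr≡0
      ... | inj₁ first≡0 with ℕ.m*n≡0⇒m≡0∨n≡0 _ first≡0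
      ...   | inj₁ 1-x≡0  = contradiction (≡.subst (λ k → 1 ∸ k ≡ 0) x≡0 1-x≡0) λ ()
      ...   | inj₂ col≡0 = contradiction col≡0 (product-nonzero (others g) _ λ g' _ →
                              ≡.subst (λ k → 1 ∸ k ℕ.* xbit g' h ≢ 0) (≡.sym (edgeless g g')) λ ())
      dominated-in-row edgeless g h nbr≡0 x≡0 | inj₂ row≡0 with product-zero (others h) _ row≡0
      ... | h' , _ , factor≡0 with complement-zero (b (x g h')) (edgeBit≤1 eH h h') factor≡0
      ...   | edge , chosen = h' , ∈-row chosen , edge

      -- in an edgeless G, a row with fewer than n_H - 1 chosen vertices makes
      -- either a neighbourhood generator or a covering generator of H
      -- (for a set of size k_H - 1 = n_H - 2 containing the row) nonvanishing
      sparse-row-witness : (∀ g g' → eGb g g' ≡ 0) → ∀ g → ∣ row g ∣ < nH ∸ 1 → NonvanishingGenerator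
      sparse-row-witness edgeless g sparse with all? (λ h → nbrValue g h ℕ.≟ 0)
      ... | no ¬allZero with ¬∀⟶∃¬ nH _ (λ h → nbrValue g h ℕ.≟ 0) ¬allZero
      ...   | h , nz = nbrX g h , nbrValue g h , nbr↦ g h , nz
      sparse-row-witness edgeless g sparse | yes allZero with
        enlarge (row g) (ℕ.∸-monoˡ-≤ 1 sparse) (ℕ.≤-trans (ℕ.m∸n≤m (nH ∸ 1) 1) (ℕ.m∸n≤m nH 1))
      ... | S , row⊆S , ∣S∣ =
        covH S (≡.trans ∣S∣ (≡.cong (_∸ 1) (≡.sym kH≡nH-1))) , coverValue eHb S , cover↦ eHH eHb eHH↦ S , nonzero
        where
        nonzero : coverValue eHb S ≢ 0
        nonzero = product-nonzero (elems (∁ S)) _ λ h h∈∁S →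
          let h∉row = λ h∈row → x∈∁p⇒x∉p (∈-elems⁻ h∈∁S) (row⊆S h∈row)
              (h' , h'∈row , edge) = dominated-in-row edgeless g h (allZero h) (∉-row h∉row)
          in sum-nonzero (elems S) (λ i → eHb i h) (∈-elems⁺ (row⊆S h'∈row))
               (λ e → contradiction (≡.trans (≡.trans (≡.sym edge) (edgeBit-sym eH h h')) e) λ ())

      witness-or-full-rows : NonvanishingGenerator ⊎ (∀ g → nH ∸ 1 ≤ ∣ row g ∣)
      witness-or-full-rows with any? (λ g₁ → any? (λ g₂ → ¬? (eGb g₁ g₂ ℕ.≟ 0)))
      ... | yes (g₁ , g₂ , edge) = inj₁ (edge-witness g₁ g₂ edge)
      ... | no noEdge with all? (λ g → nH ∸ 1 ℕ.≤? ∣ row g ∣)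
      ...   | yes full = inj₂ full
      ...   | no ¬full with ¬∀⟶∃¬ nG _ (λ g → nH ∸ 1 ℕ.≤? ∣ row g ∣) ¬full
      ...     | g , notFull = inj₁ (sparse-row-witness edgeless g (ℕ.≰⇒> notFull))
        where
        edgeless : ∀ g₁ g₂ → eGb g₁ g₂ ≡ 0
        edgeless g₁ g₂ = decidable-stable (eGb g₁ g₂ ℕ.≟ 0) λ edge → noEdge (g₁ , g₂ , edge)

      M : Carrier
      M = natK K (nH ∸ 1)

      full-row-value : ∀ g → nH ∸ 1 ≤ ∣ row g ∣ → eval b (rowSum g) ≈ M ⊎ eval b (rowSum g) ≈ 1# + M
      full-row-value g full with ℕ.m≤n⇒m<n∨m≡n (ℕ.≤-trans (∣p∣≤n (row g)) (ℕ.m≤n+m∸n nH 1))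
      ... | inj₁ <1+m = inj₁ (K.trans (_↦_.value (rowSum↦ g)) (K.reflexive (cong (natK K) (ℕ.≤-antisym (ℕ.m<1+n⇒m≤n <1+m) full))))
      ... | inj₂ ≡1+m = inj₂ (K.trans (_↦_.value (rowSum↦ g)) (K.reflexive (cong (natK K) ≡1+m)))

      rowSums : List (Fin nG) → Expr
      rowSums l = Σₗ (concat (map (λ g → map (λ h → X g h) (allFin nH)) l))

      squares : List (Fin nG) → Expr
      squares l = Σₗ (map (λ g → s g ⊗ s g) l)

      full-rows-sum : (∀ g → nH ∸ 1 ≤ ∣ row g ∣) → ∀ l →
        eval b (rowSums l) - eval b (squares l) ≈ natK K (length l ℕ.* (nH ∸ 1))
      full-rows-sum full [] = K.-‿inverseʳ 0#
      full-rows-sum full (g ∷ l) = begin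
        eval b (rowSums (g ∷ l)) - eval b (squares (g ∷ l))
          ≈⟨ K.+-congʳ (eval-Σₗ-++ b (map (λ h → X g h) (allFin nH)) _) ⟩
        (a + eval b (rowSums l)) - ((a - M) * (a - M) + eval b (squares l))
          ≈⟨ solve 4 (λ a m r q → (a :+ r) :- ((a :- m) :* (a :- m) :+ q) := (a :- (a :- m) :* (a :- m)) :+ (r :- q))
                   K.refl a M (eval b (rowSums l)) (eval b (squares l)) ⟩
        (a - (a - M) * (a - M)) + (eval b (rowSums l) - eval b (squares l))
          ≈⟨ K.+-cong (row-identity a M (full-row-value g (full g))) (full-rows-sum full l) ⟩
        M + natK K (length l ℕ.* (nH ∸ 1))
          ≈⟨ natK-+ (nH ∸ 1) _ ⟨
        natK K (length (g ∷ l) ℕ.* (nH ∸ 1)) ∎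
        where
        open import Relation.Binary.Reasoning.Setoid K.setoid
        a : Carrier
        a = eval b (rowSum g)

      full-rows-vanish : (∀ g → nH ∸ 1 ≤ ∣ row g ∣) → eval b (fviz ⊝ sumSquares) ≈ 0#
      full-rows-vanish full = begin
        (eval b (rowSums vertices) - natK K (kG ℕ.* kH)) - eval b (squares vertices)
          ≈⟨ solve 3 (λ r k q → (r :- k) :- q := (r :- q) :- k) K.refl _ _ _ ⟩
        (eval b (rowSums vertices) - eval b (squares vertices)) - natK K (kG ℕ.* kH)
          ≈⟨ K.+-congʳ (full-rows-sum full vertices) ⟩
        natK K (length vertices ℕ.* (nH ∸ 1)) - natK K (kG ℕ.* kH)
          ≡⟨ cong (λ n → natK K n - natK K (kG ℕ.* kH)) size ⟩
        natK K (kG ℕ.* kH) - natK K (kG ℕ.* kH)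
          ≈⟨ K.-‿inverseʳ _ ⟩
        0# ∎
        where
        open import Relation.Binary.Reasoning.Setoid K.setoid
        vertices : List (Fin nG)
        vertices = allFin nG
        size : length vertices ℕ.* (nH ∸ 1) ≡ kG ℕ.* kH
        size = ≡.cong₂ ℕ._*_ (≡.trans (List.length-tabulate (λ i → i)) (≡.sym kG≡nG)) (≡.sym kH≡nH-1)

      separates : (Σ Gen λ j → ∃[ y ] eval b (gens j) * y ≈ 1#) ⊎ eval b (fviz ⊝ sumSquares) ≈ 0#
      separates with witness-or-full-rows
      ... | inj₁ (j , zero , _ , nz)                 = contradiction refl nz
      ... | inj₁ (j , suc n , evaluates g≈1+n , _)   = inj₁ (j , positive-invertible n g≈1+n)
      ... | inj₂ full                                = inj₂ (full-rows-vanish full)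

  certificate : ∣ DG ∣ ≡ nG → ∣ DH ∣ ≡ nH ∸ 1 → Iviz (fviz ⊝ sumSquares)
  certificate kG≡nG kH≡nH-1 = nullstellensatz idempotent (fviz ⊝ sumSquares)
    (λ b → AtPoint.separates b kG≡nG kH≡nH-1) allVars ∈-allVars

-- The combinatorial half: γ(G) = n_G forces G to be edgeless, and then each
-- row {g} × V(H) of a dominating set of G □ H is a dominating set of H, so
-- it has at least γ(H) = n_H - 1 elements.
module ProductDomination where
  open import Defs using (Graph; module Graph; IsDominationNumber; Dominating; _□_)
  open import Data.Nat as ℕ using (ℕ; suc; _≤_; _<_; z≤n; s≤s; _∸_)
  import Data.Nat.Properties as ℕ
  open import Data.Fin as Fin using (Fin)
  import Data.Fin.Properties as Fin
  open import Data.List as List using (List; []; _∷_; map; allFin; filter; length; cartesianProduct)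
  import Data.List.Properties as List
  open import Data.List.Relation.Unary.Any as Any using (here; there; _─_)
  open import Data.List.Relation.Unary.All as All using (All)
  open import Data.List.Membership.Propositional using () renaming (_∈_ to _∈ₗ_)
  open import Data.List.Membership.Propositional.Properties using (∈-filter⁺; ∈-filter⁻; ∈-allFin)
  import Data.List.Membership.DecPropositional as DecMembership
  open import Data.List.Relation.Unary.Unique.Propositional using (Unique; _∷_)
  import Data.List.Relation.Unary.Unique.Propositional.Properties as Unique
  open import Data.Product using (_×_; _,_; proj₂)
  import Data.Product.Properties as Product
  open import Data.Sum using (inj₁; inj₂)
  open import Relation.Binary.PropositionalEquality as ≡ using (_≡_; _≢_; refl; cong)
  open import Relation.Nullary using (¬_; Dec; yes; no; ¬?)
  open import Relation.Nullary.Negation using (contradiction)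

  module _ {A : Set} where
    ∈-─ : ∀ {x y} (xs : List A) (x∈xs : x ∈ₗ xs) → y ∈ₗ xs → y ≢ x → y ∈ₗ (xs ─ x∈xs)
    ∈-─ (_ ∷ _)  (here refl)  (here refl)  y≢x = contradiction refl y≢x
    ∈-─ (_ ∷ _)  (here refl)  (there y∈xs) _   = y∈xs
    ∈-─ (_ ∷ _)  (there x∈xs) (here refl)  _   = here refl
    ∈-─ (_ ∷ xs) (there x∈xs) (there y∈xs) y≢x = there (∈-─ xs x∈xs y∈xs y≢x)

    unique-length-≤ : ∀ (L D : List A) → Unique L → (∀ {x} → x ∈ₗ L → x ∈ₗ D) → length L ≤ length D
    unique-length-≤ []      D _          _   = z≤n
    unique-length-≤ (x ∷ L) D (x∉L ∷ uL) L⊆D = ≡.subst (suc (length L) ≤_) (≡.sym (List.length-removeAt′ D _))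
      (s≤s (unique-length-≤ L (D ─ x∈D) uL λ y∈L → ∈-─ D x∈D (L⊆D (there y∈L)) λ y≡x → All.lookup x∉L y∈L (≡.sym y≡x)))
      where
      x∈D : x ∈ₗ D
      x∈D = L⊆D (here refl)

  module _ {nG nH : ℕ} (G : Graph (Fin nG)) (H : Graph (Fin nH)) where
    module G = Graph G
    module H = Graph H

    -- if γ(G) = n_G then G has no edges: otherwise V(G) ∖ {v} would dominate
    edgeless : IsDominationNumber G nG → ∀ u v → ¬ G.Adj u v
    edgeless (_ , minimal) u v u~v = ℕ.<-irrefl refl (ℕ.<-≤-trans smaller (minimal D uD dominating))
      where
      keep? : ∀ w → Dec (w ≢ v)
      keep? w = ¬? (w Fin.≟ v)
      D : List (Fin nG)
      D = filter keep? (allFin nG)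
      uD : Unique D
      uD = Unique.filter⁺ keep? (Unique.allFin⁺ nG)
      dominating : Dominating G D
      dominating w with w Fin.≟ v
      ... | yes refl = inj₂ (u , ∈-filter⁺ keep? (∈-allFin u) (λ { refl → G.irrefl u u~v }) , u~v)
      ... | no w≢v   = inj₁ (∈-filter⁺ keep? (∈-allFin w) w≢v)
      smaller : length D < nG
      smaller = ≡.subst (length D <_) (List.length-tabulate (λ i → i))
        (List.filter-notAll keep? (allFin nG) (Any.map (λ { refl v≢v → v≢v refl }) (∈-allFin v)))

    module _ (D : List (Fin nG × Fin nH)) where
      _∈D? : ∀ p → Dec (p ∈ₗ D)
      p ∈D? = DecMembership._∈?_ (Product.≡-dec Fin._≟_ Fin._≟_) p D

      rowOf : Fin nG → List (Fin nH)
      rowOf g = filter (λ h → (g , h) ∈D?) (allFin nH)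

      -- in an edgeless G a vertex (g, h) can only be dominated inside its row
      row-dominates : (∀ u v → ¬ G.Adj u v) → Dominating (G □ H) D → ∀ g → Dominating H (rowOf g)
      row-dominates noEdge dominating g h with (g , h) ∈D?
      ... | yes gh∈D = inj₁ (∈-filter⁺ (λ h → (g , h) ∈D?) (∈-allFin h) gh∈D)
      ... | no gh∉D with dominating (g , h)
      ...   | inj₁ gh∈D = contradiction gh∈D gh∉D
      ...   | inj₂ ((g' , h') , gh'∈D , inj₁ (refl , h'~h)) = inj₂ (h' , ∈-filter⁺ (λ h → (g , h) ∈D?) (∈-allFin h') gh'∈D , h'~h)
      ...   | inj₂ ((g' , h') , _ , inj₂ (g'~g , _)) = contradiction g'~g (noEdge g' g)

      rows-bound : (∀ u v → ¬ G.Adj u v) → Dominating (G □ H) D → ∀ γH → (∀ E → Unique E → Dominating H E → γH ≤ length E) →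
        ∀ gs → length gs ℕ.* γH ≤ length (filter _∈D? (cartesianProduct gs (allFin nH)))
      rows-bound noEdge dominating γH minimal [] = z≤n
      rows-bound noEdge dominating γH minimal (g ∷ gs) = ≡.subst (length (g ∷ gs) ℕ.* γH ≤_)
        (≡.sym (≡.trans (cong length (List.filter-++ _∈D? (map (g ,_) (allFin nH)) _))
                        (List.length-++ (filter _∈D? (map (g ,_) (allFin nH))))))
        (ℕ.+-mono-≤ row-bound (rows-bound noEdge dominating γH minimal gs))
        where
        row-bound : γH ≤ length (filter _∈D? (map (g ,_) (allFin nH)))
        row-bound = ≡.subst (γH ≤_) (≡.sym (length-filter-map (allFin nH)))
          (minimal (rowOf g) (Unique.filter⁺ _ (Unique.allFin⁺ nH)) (row-dominates noEdge dominating g))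
          where
          length-filter-map : ∀ hs → length (filter _∈D? (map (g ,_) hs)) ≡ length (filter (λ h → (g , h) ∈D?) hs)
          length-filter-map [] = refl
          length-filter-map (h ∷ hs) with (g , h) ∈D?
          ... | yes _ = cong suc (length-filter-map hs)
          ... | no  _ = length-filter-map hs

    domination-bound : IsDominationNumber G nG → IsDominationNumber H (nH ∸ 1) →
      ∀ m → IsDominationNumber (G □ H) m → nG ℕ.* (nH ∸ 1) ≤ m
    domination-bound γG (_ , minimalH) m ((D , _ , dominating , refl) , _) = begin
      nG ℕ.* (nH ∸ 1)                    ≡⟨ cong (ℕ._* (nH ∸ 1)) (List.length-tabulate {n = nG} (λ i → i)) ⟨
      length (allFin nG) ℕ.* (nH ∸ 1)    ≤⟨ rows-bound D (edgeless γG) dominating (nH ∸ 1) minimalH (allFin nG) ⟩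
      length (filter (_∈D? D) grid)      ≤⟨ unique-length-≤ _ D unique-members (λ p∈ → proj₂ (∈-filter⁻ (_∈D? D) {xs = grid} p∈)) ⟩
      length D                           ∎
      where
      open ℕ.≤-Reasoning
      grid : List (Fin nG × Fin nH)
      grid = cartesianProduct (allFin nG) (allFin nH)
      unique-members : Unique (filter (_∈D? D) grid)
      unique-members = Unique.filter⁺ (_∈D? D) (Unique.cartesianProduct⁺ (Unique.allFin⁺ nG) (Unique.allFin⁺ nH))

open import Defs
open import Data.Nat using (ℕ; _≤_; _*_; _∸_)
open import Data.Fin using (Fin)
open import Data.Fin.Subset using (Subset; ∣_∣)
open import Data.Product using (_×_; _,_)
open import Relation.Binary.PropositionalEquality using (_≡_)

theorem5p12 : ∀ {c ℓ} (K : CommutativeRing c ℓ) → IsCharZeroField K →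
    (nG nH : ℕ) (DG : Subset nG) (DH : Subset nH) →
    ∣ DG ∣ ≡ nG → ∣ DH ∣ ≡ nH ∸ 1 → 1 ≤ nG → 1 ≤ nH ∸ 1 →
    Viz.Iviz K nG nH DG DH (Viz._⊝_ K nG nH DG DH (Viz.fviz K nG nH DG DH) (Viz.sumSquares K nG nH DG DH))
    × ((G : Graph (Fin nG)) (H : Graph (Fin nH)) →
       IsDominationNumber G nG → IsDominationNumber H (nH ∸ 1) →
       (m : ℕ) → IsDominationNumber (G □ H) m → nG * (nH ∸ 1) ≤ m)
theorem5p12 K charZero nG nH DG DH kG≡nG kH≡nH-1 _ _ =
  VizingCertificate.certificate K charZero nG nH DG DH kG≡nG kH≡nH-1 ,
  ProductDomination.domination-bound
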